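{- Let $\alpha$ be a positive integer and let $G=(V,E)$ be a finite $\alpha$-heavy graph with average degree $d$ and maximum degree $\Delta$. Then every maximal matching of $G$ has cardinality at least \[ \frac{d}{4\Delta - \alpha - 2}\,|V|. \]
   Context: A matching of $G$ is a set of pairwise vertex-disjoint edges; it is maximal if it is maximal with respect to inclusion. For $\alpha \in \mathbb{Z}_{>0}$, a graph $G$ is called $\alpha$-heavy if for every edge $e$ of $G$ there exist at least $\alpha$ induced $4$-cycles of $G$ containing $e$ such that $e$ is the only common edge of any two of these cycles. -}

module Defs where

open import Data.Nat using (ℕ; _⊔_)
open import Data.Fin using (Fin)
open import Data.Bool using (Bool; true; false; T; if_then_else_)
open import Data.List using (List; _∷_; map; foldr; allFin; length)
open import Data.Nat.ListAction using (sum)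
open import Data.List.Relation.Unary.All using (All)
open import Data.List.Relation.Unary.AllPairs using (AllPairs)
open import Data.Product using (_×_; _,_; Σ)
open import Data.Sum using (_⊎_)
open import Relation.Binary.PropositionalEquality using (_≡_; _≢_)
open import Relation.Nullary using (¬_)

record Graph (n : ℕ) : Set where
  field
    adj   : Fin n → Fin n → Bool
    sym   : ∀ u v → adj u v ≡ adj v u
    irrefl : ∀ u → adj u u ≡ false

open Graph public

module _ {n : ℕ} (G : Graph n) where

  Adj : Fin n → Fin n → Set
  Adj u v = T (adj G u v)

  deg : Fin n → ℕ
  deg v = sum (map (λ w → if adj G v w then 1 else 0) (allFin n))

  -- sum of degrees  ( = average degree d times |V| )
  degSum : ℕ
  degSum = sum (map deg (allFin n))

  -- maximum degree Δ (0 for the empty graph)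
  maxDeg : ℕ
  maxDeg = foldr _⊔_ 0 (map deg (allFin n))

  SameEdge : Fin n → Fin n → Fin n → Fin n → Set
  SameEdge x y u v = (x ≡ u × y ≡ v) ⊎ (x ≡ v × y ≡ u)

  record C4 : Set where
    field
      a b c d : Fin n
      a≢b : a ≢ b
      a≢c : a ≢ c
      a≢d : a ≢ d
      b≢c : b ≢ c
      b≢d : b ≢ d
      c≢d : c ≢ d
      ab : Adj a b
      bc : Adj b c
      cd : Adj c d
      da : Adj d a
      ¬ac : ¬ Adj a c
      ¬bd : ¬ Adj b d

  HasEdge : C4 → Fin n → Fin n → Set
  HasEdge C x y = SameEdge x y a b ⊎ SameEdge x y b c ⊎ SameEdge x y c d ⊎ SameEdge x y d a
    where open C4 C

  Heavy : ℕ → Set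
  Heavy α = ∀ u v → Adj u v →
    Σ (Fin α → C4) λ cs →
      (∀ i → HasEdge (cs i) u v) ×
      (∀ i j → i ≢ j → ∀ x y → HasEdge (cs i) x y → HasEdge (cs j) x y → SameEdge x y u v)

  Disjoint : Fin n × Fin n → Fin n × Fin n → Set
  Disjoint (a , b) (c , d) = a ≢ c × a ≢ d × b ≢ c × b ≢ d

  -- a matching: a list of edges, pairwise vertex-disjoint
  -- (so in particular without repetitions, even up to orientation)
  IsMatching : List (Fin n × Fin n) → Set
  IsMatching M = All (λ e → Adj (Data.Product.proj₁ e) (Data.Product.proj₂ e)) M × AllPairs Disjoint M

  IsMaximalMatching : List (Fin n × Fin n) → Set
  IsMaximalMatching M = IsMatching M × (∀ u v → Adj u v → ¬ IsMatching ((u , v) ∷ M))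

{-# OPTIONS --safe #-}
module Submission where

-- Let W be the indicator of the set V(M) of the 2|M| vertices covered by M, and e(V(M)) the
-- number of edges inside it.  By maximality V(M) is a vertex cover, so every ordered pair
-- (v , w) of adjacent vertices has 1 + W v W w ≤ W v + W w; summing over these pairs gives
--   Σ deg + 2 e(V(M)) ≤ 2 Σ_{v ∈ V(M)} deg v ≤ 4 Δ |M|.
-- For a matching edge uv, u and v are covered neighbours of each other, and each of the α
-- cycles u v x y through uv contributes a covered neighbour x of v or y of u (xy is an edge);
-- these are all distinct because two of the cycles share no edge besides uv.  So every
-- matching edge adds at least 2 + α to 2 e(V(M)) = Σ_{v ∈ V(M)} |N(v) ∩ V(M)|.

open import Defs
open import Data.Nat using (ℕ; _>_)
open import Data.List using (List; length)
open import Data.Fin using (Fin)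
open import Data.Product using (_×_)

open import Data.Bool using (true; false; T; if_then_else_)
open import Data.Empty using (⊥-elim)
open import Data.Fin using (zero; suc)
open import Data.Fin.Properties using (_≟_)
open import Data.List using ([]; _∷_; map; tabulate; foldr)
open import Data.List.Membership.Propositional using (_∈_)
open import Data.List.Membership.Propositional.Properties using (∈-map⁺; ∈-allFin)
open import Data.List.Relation.Unary.All as All using (All; []; _∷_)
import Data.List.Relation.Unary.All.Properties as Allₚ
open import Data.List.Relation.Unary.Any using (here; there)
open import Data.List.Relation.Unary.Unique.Propositional using (Unique)
open import Data.List.Relation.Unary.AllPairs using ([]; _∷_)
import Data.List.Relation.Unary.Unique.Propositional.Properties as Unique
open import Data.Nat.ListAction using (sum)
open import Data.Product using (_,_; proj₁; proj₂)
open import Data.Sum using (_⊎_; inj₁; inj₂)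
open import Function using (id; _∘_)
open import Relation.Binary.PropositionalEquality as ≡ using (_≡_; _≢_; refl; cong; cong₂; subst; ≢-sym)
open import Relation.Nullary using (¬_; yes; no)

module _ where
  open import Data.Nat using (zero; suc; _+_; _*_; _≤_; _⊔_; z≤n; s≤s)
  open import Data.Nat.Properties hiding (_≟_)
  open import Algebra.Properties.Semiring.Sum +-*-semiring
    using (sum-syntax; sum-cong-≗; sum-replicate-zero; ∑-distrib-+)
    renaming (sum to ∑)
  open ≤-Reasoning

  1+m*n≤m+n : ∀ {m n} → m ≤ 1 → n ≤ 1 → 1 ≤ m + n → 1 + m * n ≤ m + n
  1+m*n≤m+n z≤n       z≤n       ()
  1+m*n≤m+n z≤n       (s≤s z≤n) _ = ≤-refl
  1+m*n≤m+n (s≤s z≤n) z≤n       _ = ≤-refl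
  1+m*n≤m+n (s≤s z≤n) (s≤s z≤n) _ = ≤-refl

  ∈⇒≤-foldr-⊔ : ∀ {x xs} → x ∈ xs → x ≤ foldr _⊔_ 0 xs
  ∈⇒≤-foldr-⊔ (here refl)  = m≤m⊔n _ _
  ∈⇒≤-foldr-⊔ (there x∈xs) = ≤-trans (∈⇒≤-foldr-⊔ x∈xs) (m≤n⊔m _ _)

  sum-map-mono-≤ : ∀ {A : Set} {f g : A → ℕ} {xs} → All (λ x → f x ≤ g x) xs → sum (map f xs) ≤ sum (map g xs)
  sum-map-mono-≤ []           = z≤n
  sum-map-mono-≤ (fx≤gx ∷ ps) = +-mono-≤ fx≤gx (sum-map-mono-≤ ps)

  sum-map-tabulate : ∀ {A : Set} {k} (f : Fin k → A) (g : A → ℕ) → sum (map g (tabulate f)) ≡ ∑[ i < k ] g (f i)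
  sum-map-tabulate {k = zero}  f g = refl
  sum-map-tabulate {k = suc k} f g = cong (g (f zero) +_) (sum-map-tabulate (f ∘ suc) g)

  ∑-mono-≤ : ∀ {k} {f g : Fin k → ℕ} → (∀ i → f i ≤ g i) → ∑ f ≤ ∑ g
  ∑-mono-≤ {zero}  _   = z≤n
  ∑-mono-≤ {suc k} f≤g = +-mono-≤ (f≤g zero) (∑-mono-≤ (f≤g ∘ suc))

  ∑-≥ : ∀ {k c} {f : Fin k → ℕ} → (∀ i → c ≤ f i) → k * c ≤ ∑ f
  ∑-≥ {zero}  _   = z≤n
  ∑-≥ {suc k} c≤f = +-mono-≤ (c≤f zero) (∑-≥ (c≤f ∘ suc))

  ∑∑-distrib-+ : ∀ {k l} (f g : Fin k → Fin l → ℕ) →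
    ∑[ i < k ] ∑[ j < l ] (f i j + g i j) ≡ ∑[ i < k ] ∑[ j < l ] f i j + ∑[ i < k ] ∑[ j < l ] g i j
  ∑∑-distrib-+ f g =
    ≡.trans (sum-cong-≗ (λ i → ∑-distrib-+ (f i) (g i))) (∑-distrib-+ (λ i → ∑ (f i)) (λ i → ∑ (g i)))

  δ : ∀ {n} → Fin n → Fin n → ℕ
  δ zero    zero    = 1
  δ zero    (suc _) = 0
  δ (suc _) zero    = 0
  δ (suc i) (suc j) = δ i j

  δ-refl : ∀ {n} (i : Fin n) → δ i i ≡ 1
  δ-refl zero    = refl
  δ-refl (suc i) = δ-refl i

  δ-≢ : ∀ {n} {i j : Fin n} → i ≢ j → δ i j ≡ 0
  δ-≢ {i = zero}  {zero}  i≢j = ⊥-elim (i≢j refl)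
  δ-≢ {i = zero}  {suc _} _   = refl
  δ-≢ {i = suc _} {zero}  _   = refl
  δ-≢ {i = suc _} {suc _} i≢j = δ-≢ (i≢j ∘ cong suc)

  ∑-δ : ∀ {n} (j : Fin n) (f : Fin n → ℕ) → ∑[ i < n ] (δ i j * f i) ≡ f j
  ∑-δ {suc n} zero    f = ≡.trans (cong₂ _+_ (*-identityˡ (f zero)) (sum-replicate-zero n)) (+-identityʳ (f zero))
  ∑-δ {suc n} (suc j) f = ∑-δ j (f ∘ suc)

  multiplicity : ∀ {n} → Fin n → List (Fin n) → ℕ
  multiplicity i xs = sum (map (δ i) xs)

  ∑-multiplicity : ∀ {n} (xs : List (Fin n)) (f : Fin n → ℕ) →
    ∑[ i < n ] (multiplicity i xs * f i) ≡ sum (map f xs)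
  ∑-multiplicity {n} []       f = sum-replicate-zero n
  ∑-multiplicity {n} (x ∷ xs) f = begin-equality
    ∑[ i < n ] ((δ i x + multiplicity i xs) * f i)
      ≡⟨ sum-cong-≗ (λ i → *-distribʳ-+ (f i) (δ i x) _) ⟩
    ∑[ i < n ] (δ i x * f i + multiplicity i xs * f i)
      ≡⟨ ∑-distrib-+ (λ i → δ i x * f i) (λ i → multiplicity i xs * f i) ⟩
    ∑[ i < n ] (δ i x * f i) + ∑[ i < n ] (multiplicity i xs * f i)
      ≡⟨ cong₂ _+_ (∑-δ x f) (∑-multiplicity xs f) ⟩
    f x + sum (map f xs)
      ∎

  multiplicity-∉ : ∀ {n} {i : Fin n} {xs} → All (i ≢_) xs → multiplicity i xs ≡ 0
  multiplicity-∉ []            = refl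
  multiplicity-∉ (i≢x ∷ i∉xs) = cong₂ _+_ (δ-≢ i≢x) (multiplicity-∉ i∉xs)

  multiplicity-≤1 : ∀ {n} (i : Fin n) {xs} → Unique xs → multiplicity i xs ≤ 1
  multiplicity-≤1 i          []            = z≤n
  multiplicity-≤1 i {x ∷ xs} (x∉xs ∷ uniq) with i ≟ x
  ... | yes refl = ≤-reflexive (cong₂ _+_ (δ-refl i) (multiplicity-∉ x∉xs))
  ... | no i≢x   = ≤-trans (≤-reflexive (cong (_+ multiplicity i xs) (δ-≢ i≢x))) (multiplicity-≤1 i uniq)

  ∈⇒1≤multiplicity : ∀ {n} {i : Fin n} {xs} → i ∈ xs → 1 ≤ multiplicity i xs
  ∈⇒1≤multiplicity {i = i} (here refl) = ≤-trans (≤-reflexive (≡.sym (δ-refl i))) (m≤m+n _ _)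
  ∈⇒1≤multiplicity         (there i∈xs) = ≤-trans (∈⇒1≤multiplicity i∈xs) (m≤n+m _ _)

  sum-map-≤-∑ : ∀ {n} {xs : List (Fin n)} {f : Fin n → ℕ} → Unique xs → sum (map f xs) ≤ ∑ f
  sum-map-≤-∑ {n} {xs} {f} uniq = begin
    sum (map f xs)                           ≡⟨ ∑-multiplicity xs f ⟨
    ∑[ i < n ] (multiplicity i xs * f i)     ≤⟨ ∑-mono-≤ (λ i → *-monoˡ-≤ (f i) (multiplicity-≤1 i uniq)) ⟩
    ∑[ i < n ] (1 * f i)                     ≡⟨ sum-cong-≗ (λ i → *-identityˡ (f i)) ⟩
    ∑ f                                      ∎

  endpoints : ∀ {A : Set} → List (A × A) → List A
  endpoints []            = []
  endpoints ((u , v) ∷ M) = u ∷ v ∷ endpoints M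

  ∈⇒∈-endpoints : ∀ {A : Set} {u v : A} {M} → (u , v) ∈ M → u ∈ endpoints M × v ∈ endpoints M
  ∈⇒∈-endpoints (here refl)  = here refl , there (here refl)
  ∈⇒∈-endpoints (there uv∈M) = let u∈E , v∈E = ∈⇒∈-endpoints uv∈M in there (there u∈E) , there (there v∈E)

  sum-endpoints-≤ : ∀ {A : Set} {f : A → ℕ} {c} → (∀ x → f x ≤ c) → ∀ M →
    sum (map f (endpoints M)) ≤ length M * (c + c)
  sum-endpoints-≤         f≤c []            = z≤n
  sum-endpoints-≤ {c = c} f≤c ((u , v) ∷ M) =
    ≤-trans (+-mono-≤ (f≤c u) (+-mono-≤ (f≤c v) (sum-endpoints-≤ f≤c M))) (≤-reflexive (≡.sym (+-assoc c c _)))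

  sum-endpoints-≥ : ∀ {A : Set} {f : A → ℕ} {c} {M} → All (λ e → c ≤ f (proj₁ e) + f (proj₂ e)) M →
    length M * c ≤ sum (map f (endpoints M))
  sum-endpoints-≥                           []             = z≤n
  sum-endpoints-≥ {f = f} {M = (u , v) ∷ _} (c≤fu+fv ∷ ps) =
    ≤-trans (+-mono-≤ c≤fu+fv (sum-endpoints-≥ ps)) (≤-reflexive (+-assoc (f u) (f v) _))

module _ {n : ℕ} (G : Graph n) where
  open import Data.Nat using (_+_; _*_; _≤_; z≤n)
  open import Data.Nat.Properties hiding (_≟_)
  open import Data.Nat.Tactic.RingSolver using (solve-∀)
  open import Algebra.Properties.Semiring.Sum +-*-semiring
    using (sum-syntax; sum-cong-≗; ∑-distrib-+; ∑-comm; *-distribˡ-sum)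
    renaming (sum to ∑)
  open import Algebra.Properties.CommutativeSemigroup +-commutativeSemigroup using (interchange)
  open import Data.List.Membership.DecPropositional (_≟_ {n}) using (_∈?_)
  open ≤-Reasoning

  Adj-sym : ∀ {v w} → Adj G v w → Adj G w v
  Adj-sym {v} {w} = subst T (sym G v w)

  Adj⇒≢ : ∀ {v w} → Adj G v w → v ≢ w
  Adj⇒≢ {v} v~v refl = subst T (irrefl G v) v~v

  A : Fin n → Fin n → ℕ
  A v w = if adj G v w then 1 else 0

  A-sym : ∀ v w → A v w ≡ A w v
  A-sym v w = cong (if_then 1 else 0) (sym G v w)

  Adj⇒A≡1 : ∀ {v w} → Adj G v w → A v w ≡ 1
  Adj⇒A≡1 {v} {w} v~w with adj G v w
  ... | true = refl

  A-*-mono-≤ : ∀ v w {x y} → (Adj G v w → x ≤ y) → A v w * x ≤ A v w * y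
  A-*-mono-≤ v w x≤y with adj G v w
  ... | true  = *-monoʳ-≤ 1 (x≤y _)
  ... | false = z≤n

  deg≡∑A : ∀ v → deg G v ≡ ∑ (A v)
  deg≡∑A v = sum-map-tabulate id (A v)

  degSum≡∑deg : degSum G ≡ ∑ (deg G)
  degSum≡∑deg = sum-map-tabulate id (deg G)

  deg≤maxDeg : ∀ v → deg G v ≤ maxDeg G
  deg≤maxDeg v = ∈⇒≤-foldr-⊔ (∈-map⁺ (deg G) (∈-allFin v))

  degIn : (Fin n → ℕ) → Fin n → ℕ
  degIn W v = ∑[ w < n ] (A v w * W w)

  IsVertexCover : (Fin n → ℕ) → Set
  IsVertexCover W = ∀ {v w} → Adj G v w → 1 ≤ W v + W w

  ∑∑-*-A : ∀ (f : Fin n → ℕ) → ∑[ v < n ] ∑[ w < n ] (f v * A v w) ≡ ∑[ v < n ] (f v * deg G v)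
  ∑∑-*-A f = sum-cong-≗ λ v → ≡.trans (≡.sym (*-distribˡ-sum (f v) (A v))) (cong (f v *_) (≡.sym (deg≡∑A v)))

  ∑∑-A-* : ∀ (f : Fin n → ℕ) → ∑[ v < n ] ∑[ w < n ] (A v w * f w) ≡ ∑[ w < n ] (f w * deg G w)
  ∑∑-A-* f = begin-equality
    ∑[ v < n ] ∑[ w < n ] (A v w * f w) ≡⟨ ∑-comm (λ v w → A v w * f w) ⟩
    ∑[ w < n ] ∑[ v < n ] (A v w * f w) ≡⟨ sum-cong-≗ (λ w → sum-cong-≗ (λ v → A-*-comm v w)) ⟩
    ∑[ w < n ] ∑[ v < n ] (f w * A w v) ≡⟨ ∑∑-*-A f ⟩
    ∑[ w < n ] (f w * deg G w)          ∎
    where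
    A-*-comm : ∀ v w → A v w * f w ≡ f w * A w v
    A-*-comm v w = ≡.trans (cong (_* f w) (A-sym v w)) (*-comm (A w v) (f w))

  vertexCover-degSum-≤ : ∀ {W} → (∀ v → W v ≤ 1) → IsVertexCover W →
    degSum G + ∑[ v < n ] (W v * degIn W v) ≤ ∑[ v < n ] (W v * deg G v) + ∑[ v < n ] (W v * deg G v)
  vertexCover-degSum-≤ {W} W≤1 cover = begin
    degSum G + ∑[ v < n ] (W v * degIn W v)
      ≡⟨ cong₂ _+_ (≡.trans degSum≡∑deg (sum-cong-≗ deg≡∑A))
                   (sum-cong-≗ λ v → *-distribˡ-sum (W v) (λ w → A v w * W w)) ⟩
    ∑[ v < n ] ∑[ w < n ] A v w + ∑[ v < n ] ∑[ w < n ] (W v * (A v w * W w))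
      ≡⟨ ∑∑-distrib-+ A (λ v w → W v * (A v w * W w)) ⟨
    ∑[ v < n ] ∑[ w < n ] (A v w + W v * (A v w * W w))
      ≡⟨ sum-cong-≗ (λ v → sum-cong-≗ (λ w → lhs-form (A v w) (W v) (W w))) ⟩
    ∑[ v < n ] ∑[ w < n ] (A v w * (1 + W v * W w))
      ≤⟨ ∑-mono-≤ (λ v → ∑-mono-≤ (λ w → A-*-mono-≤ v w λ v~w →
                                               1+m*n≤m+n (W≤1 v) (W≤1 w) (cover v~w))) ⟩
    ∑[ v < n ] ∑[ w < n ] (A v w * (W v + W w))
      ≡⟨ sum-cong-≗ (λ v → sum-cong-≗ (λ w → rhs-form (A v w) (W v) (W w))) ⟩
    ∑[ v < n ] ∑[ w < n ] (W v * A v w + A v w * W w)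
      ≡⟨ ∑∑-distrib-+ (λ v w → W v * A v w) (λ v w → A v w * W w) ⟩
    ∑[ v < n ] ∑[ w < n ] (W v * A v w) + ∑[ v < n ] ∑[ w < n ] (A v w * W w)
      ≡⟨ cong₂ _+_ (∑∑-*-A W) (∑∑-A-* W) ⟩
    ∑[ v < n ] (W v * deg G v) + ∑[ v < n ] (W v * deg G v) ∎
    where
    lhs-form : ∀ a p q → a + p * (a * q) ≡ a * (1 + p * q)
    lhs-form = solve-∀
    rhs-form : ∀ a p q → a * (p + q) ≡ p * a + a * q
    rhs-form = solve-∀

  All-Disjoint⇒∉-endpoints : ∀ {u v} M → All (Disjoint G (u , v)) M →
    All (u ≢_) (endpoints M) × All (v ≢_) (endpoints M)
  All-Disjoint⇒∉-endpoints []            []                               = [] , []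
  All-Disjoint⇒∉-endpoints ((c , d) ∷ M) ((u≢c , u≢d , v≢c , v≢d) ∷ uv#M) =
    let u∉ , v∉ = All-Disjoint⇒∉-endpoints M uv#M in (u≢c ∷ u≢d ∷ u∉) , (v≢c ∷ v≢d ∷ v∉)

  ∉-endpoints⇒All-Disjoint : ∀ {u v} M → All (u ≢_) (endpoints M) → All (v ≢_) (endpoints M) →
    All (Disjoint G (u , v)) M
  ∉-endpoints⇒All-Disjoint []            []               []               = []
  ∉-endpoints⇒All-Disjoint ((c , d) ∷ M) (u≢c ∷ u≢d ∷ u∉) (v≢c ∷ v≢d ∷ v∉) =
    (u≢c , u≢d , v≢c , v≢d) ∷ ∉-endpoints⇒All-Disjoint M u∉ v∉

  matching⇒Unique-endpoints : ∀ {M} → IsMatching G M → Unique (endpoints M)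
  matching⇒Unique-endpoints {[]}          _                            = []
  matching⇒Unique-endpoints {(u , v) ∷ M} (u~v ∷ adjs , uv#M ∷ disj) =
    let u∉ , v∉ = All-Disjoint⇒∉-endpoints M uv#M
    in (Adj⇒≢ u~v ∷ u∉) ∷ v∉ ∷ matching⇒Unique-endpoints (adjs , disj)

  maximalMatching-covers : ∀ {M v w} → IsMaximalMatching G M → Adj G v w →
    v ∈ endpoints M ⊎ w ∈ endpoints M
  maximalMatching-covers {M} {v} {w} ((adjs , disj) , maximal) v~w with v ∈? endpoints M | w ∈? endpoints M
  ... | yes v∈E | _       = inj₁ v∈E
  ... | no _    | yes w∈E = inj₂ w∈E
  ... | no v∉E  | no w∉E  = ⊥-elim (maximal v w v~w (v~w ∷ adjs , vw#M ∷ disj))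
    where vw#M = ∉-endpoints⇒All-Disjoint M (Allₚ.¬Any⇒All¬ _ v∉E) (Allₚ.¬Any⇒All¬ _ w∉E)

  pattern forward  = inj₁ (refl , refl)
  pattern backward = inj₂ (refl , refl)
  pattern edge-ab e = inj₁ e
  pattern edge-bc e = inj₂ (inj₁ e)
  pattern edge-cd e = inj₂ (inj₂ (inj₁ e))
  pattern edge-da e = inj₂ (inj₂ (inj₂ e))

  record Completion (C : C4 G) (u v : Fin n) : Set where
    constructor completion
    field
      x y  : Fin n
      v~x  : Adj G v x
      x~y  : Adj G x y
      u~y  : Adj G u y
      x≢u  : x ≢ u
      y≢v  : y ≢ v
      vx∈C : HasEdge G C v x
      uy∈C : HasEdge G C u y

  module _ (C : C4 G) where
    open C4 C

    completion-of : ∀ {u v} → HasEdge G C u v → Completion C u v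
    completion-of (edge-ab forward)  =
      completion c d bc cd (Adj-sym da) (≢-sym a≢c) (≢-sym b≢d) (edge-bc forward) (edge-da backward)
    completion-of (edge-ab backward) =
      completion d c (Adj-sym da) (Adj-sym cd) bc (≢-sym b≢d) (≢-sym a≢c) (edge-da backward) (edge-bc forward)
    completion-of (edge-bc forward)  =
      completion d a cd da (Adj-sym ab) (≢-sym b≢d) a≢c (edge-cd forward) (edge-ab backward)
    completion-of (edge-bc backward) =
      completion a d (Adj-sym ab) (Adj-sym da) cd a≢c (≢-sym b≢d) (edge-ab backward) (edge-cd forward)
    completion-of (edge-cd forward)  =
      completion a b da ab (Adj-sym bc) a≢c b≢d (edge-da forward) (edge-bc backward)
    completion-of (edge-cd backward) =
      completion b a (Adj-sym bc) (Adj-sym ab) da b≢d a≢c (edge-bc backward) (edge-da forward)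
    completion-of (edge-da forward)  =
      completion b c ab bc (Adj-sym cd) b≢d (≢-sym a≢c) (edge-ab forward) (edge-cd backward)
    completion-of (edge-da backward) =
      completion c b (Adj-sym cd) (Adj-sym bc) ab (≢-sym a≢c) b≢d (edge-cd backward) (edge-ab forward)

  cycleEdges-injective : ∀ {α u v} (cs : Fin α → C4 G) →
    (∀ i j → i ≢ j → ∀ x y → HasEdge G (cs i) x y → HasEdge G (cs j) x y → SameEdge G x y u v) →
    ∀ w (z : Fin α → Fin n) → (∀ i → HasEdge G (cs i) w (z i)) → (∀ i → ¬ SameEdge G w (z i) u v) →
    ∀ {i j} → z i ≡ z j → i ≡ j
  cycleEdges-injective cs meet w z wz∈cs wz≢uv {i} {j} zi≡zj with i ≟ j
  ... | yes i≡j = i≡j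
  ... | no i≢j  = ⊥-elim (wz≢uv i (meet i j i≢j w (z i) (wz∈cs i) wzi∈csj))
    where wzi∈csj = subst (HasEdge G (cs j) w) (≡.sym zi≡zj) (wz∈cs j)

  degIn-≥-neighbours : ∀ {k W v u} (z : Fin k → Fin n) → Adj G v u → (∀ i → Adj G v (z i)) →
    (∀ i → z i ≢ u) → (∀ {i j} → z i ≡ z j → i ≡ j) → W u + ∑[ i < k ] W (z i) ≤ degIn W v
  degIn-≥-neighbours {W = W} {v} {u} z v~u v~z z≢u z-injective = begin
    W u + ∑ (W ∘ z)
      ≡⟨ cong (W u +_) (sum-map-tabulate z W) ⟨
    sum (map W (u ∷ tabulate z))
      ≤⟨ sum-map-mono-≤ (All.map W≤AW (v~u ∷ Allₚ.tabulate⁺ v~z)) ⟩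
    sum (map (λ w → A v w * W w) (u ∷ tabulate z))
      ≤⟨ sum-map-≤-∑ (Allₚ.tabulate⁺ (≢-sym ∘ z≢u) ∷ Unique.tabulate⁺ z-injective) ⟩
    degIn W v
      ∎
    where
    W≤AW : ∀ {w} → Adj G v w → W w ≤ A v w * W w
    W≤AW v~w = ≤-reflexive (≡.sym (≡.trans (cong (_* W _) (Adj⇒A≡1 v~w)) (*-identityˡ _)))

  heavy⇒degIn-≥ : ∀ {α W u v} → Heavy G α → IsVertexCover W → Adj G u v → 1 ≤ W u → 1 ≤ W v →
    2 + α ≤ degIn W u + degIn W v
  heavy⇒degIn-≥ {α} {W} {u} {v} heavy cover u~v 1≤Wu 1≤Wv with heavy u v u~v
  ... | cs , uv∈cs , meet = begin
    2 + α                     ≤⟨ +-mono-≤ (+-mono-≤ 1≤Wv 1≤Wu) α≤Y+X ⟩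
    (W v + W u) + (Y + X)     ≡⟨ interchange (W v) (W u) Y X ⟩
    (W v + Y) + (W u + X)     ≤⟨ +-mono-≤ (degIn-≥-neighbours y u~v u~y y≢v y-injective)
                                          (degIn-≥-neighbours x (Adj-sym u~v) v~x x≢u x-injective) ⟩
    degIn W u + degIn W v     ∎
    where
    completions : ∀ i → Completion (cs i) u v
    completions i = completion-of (cs i) (uv∈cs i)
    open module Completions i = Completion (completions i)
    X Y : ℕ
    X = ∑ (W ∘ x)
    Y = ∑ (W ∘ y)
    x-injective : ∀ {i j} → x i ≡ x j → i ≡ j
    x-injective = cycleEdges-injective cs meet v x vx∈C λ where
      i (inj₁ (v≡u , _)) → Adj⇒≢ u~v (≡.sym v≡u)
      i (inj₂ (_ , x≡u)) → x≢u i x≡u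
    y-injective : ∀ {i j} → y i ≡ y j → i ≡ j
    y-injective = cycleEdges-injective cs meet u y uy∈C λ where
      i (inj₁ (_ , y≡v)) → y≢v i y≡v
      i (inj₂ (u≡v , _)) → Adj⇒≢ u~v u≡v
    α≤Y+X : α ≤ Y + X
    α≤Y+X = begin
      α                              ≡⟨ *-identityʳ α ⟨
      α * 1                          ≤⟨ ∑-≥ (λ i → cover (Adj-sym (x~y i))) ⟩
      ∑[ i < α ] (W (y i) + W (x i)) ≡⟨ ∑-distrib-+ (W ∘ y) (W ∘ x) ⟩
      Y + X                          ∎

  maximalMatching-bound : ∀ {α M} → Heavy G α → IsMaximalMatching G M →
    degSum G + length M * (2 + α) ≤ length M * (4 * maxDeg G)
  maximalMatching-bound {α} {M} heavy maximal@(matching , _) = begin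
    degSum G + length M * (2 + α)
      ≤⟨ +-monoʳ-≤ (degSum G) (sum-endpoints-≥ (All.tabulate edge-bound)) ⟩
    degSum G + sum (map (degIn W) E)
      ≡⟨ cong (degSum G +_) (∑-multiplicity E (degIn W)) ⟨
    degSum G + ∑[ v < n ] (W v * degIn W v)
      ≤⟨ vertexCover-degSum-≤ W≤1 W-cover ⟩
    ∑[ v < n ] (W v * deg G v) + ∑[ v < n ] (W v * deg G v)
      ≡⟨ cong₂ _+_ (∑-multiplicity E (deg G)) (∑-multiplicity E (deg G)) ⟩
    sum (map (deg G) E) + sum (map (deg G) E)
      ≤⟨ +-mono-≤ (sum-endpoints-≤ deg≤maxDeg M) (sum-endpoints-≤ deg≤maxDeg M) ⟩
    length M * (Δ + Δ) + length M * (Δ + Δ)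
      ≡⟨ four-halves (length M) Δ ⟩
    length M * (4 * Δ)
      ∎
    where
    Δ = maxDeg G
    E = endpoints M
    four-halves : ∀ l d → l * (d + d) + l * (d + d) ≡ l * (4 * d)
    four-halves = solve-∀
    W : Fin n → ℕ
    W v = multiplicity v E
    W≤1 : ∀ v → W v ≤ 1
    W≤1 v = multiplicity-≤1 v (matching⇒Unique-endpoints matching)
    W-cover : IsVertexCover W
    W-cover v~w with maximalMatching-covers maximal v~w
    ... | inj₁ v∈E = ≤-trans (∈⇒1≤multiplicity v∈E) (m≤m+n _ _)
    ... | inj₂ w∈E = ≤-trans (∈⇒1≤multiplicity w∈E) (m≤n+m _ _)
    edge-bound : ∀ {e} → e ∈ M → 2 + α ≤ degIn W (proj₁ e) + degIn W (proj₂ e)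
    edge-bound e∈M = let u∈E , v∈E = ∈⇒∈-endpoints e∈M in
      heavy⇒degIn-≥ heavy W-cover (All.lookup (proj₁ matching) e∈M) (∈⇒1≤multiplicity u∈E) (∈⇒1≤multiplicity v∈E)

open import Data.Integer using (+_; _*_; _-_; _≤_)
open import Data.Integer using (_+_; -_; +≤+)
open import Data.Integer.Properties using (pos-+; pos-*; +-monoˡ-≤; module ≤-Reasoning)
open import Data.Integer.Tactic.RingSolver using (solve-∀)
import Data.Nat as ℕ

ℕ-bound⇒ℤ-bound : ∀ {d x} l a → d ℕ.+ l ℕ.* (2 ℕ.+ a) ℕ.≤ l ℕ.* x → + d ≤ + l * (+ x - + a - + 2)
ℕ-bound⇒ℤ-bound {d} {x} l a h = begin
  + d                                    ≡⟨ cancel (+ d) k ⟩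
  + d + k - k                            ≡⟨ cong (_- k) cast ⟨
  + (d ℕ.+ l ℕ.* (2 ℕ.+ a)) - k          ≤⟨ +-monoˡ-≤ (- k) (+≤+ h) ⟩
  + (l ℕ.* x) - k                        ≡⟨ cong (_- k) (pos-* l x) ⟩
  + l * + x - + l * (+ 2 + + a)          ≡⟨ factor (+ l) (+ x) (+ a) ⟩
  + l * (+ x - + a - + 2)                ∎
  where
  open ≤-Reasoning
  k = + l * + (2 ℕ.+ a)
  cast : + (d ℕ.+ l ℕ.* (2 ℕ.+ a)) ≡ + d + k
  cast = ≡.trans (pos-+ d _) (cong (_+_ (+ d)) (pos-* l (2 ℕ.+ a)))
  cancel : ∀ i j → i ≡ i + j - j
  cancel = solve-∀
  factor : ∀ i y b → i * y - i * (+ 2 + b) ≡ i * (y - b - + 2)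
  factor = solve-∀

-- The bound holds for α = 0 as well.
proposition3p2 : (α : ℕ) → α > 0 → (n : ℕ) → (G : Graph n) → Heavy G α →
    (M : List (Fin n × Fin n)) → IsMaximalMatching G M →
    + degSum G ≤ (+ length M) * (+ (4 Data.Nat.* maxDeg G) - + α - + 2)
proposition3p2 α _ n G heavy M maximal = ℕ-bound⇒ℤ-bound (length M) α (maximalMatching-bound G heavy maximal)
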